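{- Let $p$ be a prime, $q=p^n$ with $q\equiv 1 \pmod 3$, and let $\delta\in\mathbb{F}_q$ be a cubic nonresidue. Let $\mathbb{H}_q$ be the set of pairs $(\alpha,\beta)\in \mathbb{F}_q(\sqrt[3]{\delta})\times\mathbb{F}_q(\sqrt[3]{\delta})$ with $\alpha=\alpha_1+\alpha_2\delta^{1/3}+\alpha_3\delta^{2/3}$, $\beta=\beta_1+\beta_2\delta^{1/3}+\beta_3\delta^{2/3}$ ($\alpha_i,\beta_i\in\mathbb{F}_q$) such that $\alpha_2\beta_3-\alpha_3\beta_2\neq 0$. Then the rule \[ \begin{bmatrix} a & b & c\\ d & e & f\\ r & s & t\end{bmatrix}\cdot(\alpha,\beta)=\left(\frac{a\alpha+b\beta+c}{r\alpha+s\beta+t},\ \frac{d\alpha+e\beta+f}{r\alpha+s\beta+t}\right) \] defines an action of $\mathrm{GL}_3(\mathbb{F}_q)$ on $\mathbb{H}_q$ (in particular the denominator is nonzero and the image lies in $\mathbb{H}_q$).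
   Context: $\mathbb{F}_q(\sqrt[3]{\delta})\cong\mathbb{F}_{q^3}$ is the cubic extension of $\mathbb{F}_q$ obtained by adjoining a cube root $\delta^{1/3}$ of $\delta$; it has $\mathbb{F}_q$-basis $\{1,\delta^{1/3},\delta^{2/3}\}$, and $\alpha_1,\alpha_2,\alpha_3$ denote the coordinates of $\alpha$ in this basis. -}

module Defs where

open import Data.Fin using (Fin; zero; suc)
open import Data.Product using (_×_; _,_; proj₁; proj₂)
open import Relation.Binary.PropositionalEquality using (_≡_)
open import Relation.Nullary using (¬_)
open import Algebra.Core using (Op₁; Op₂)
open import Algebra.Structures using (IsCommutativeRing)

-- A field whose equality is propositional equality.
-- The multiplicative inverse is a total function; its value at 0 is
-- unconstrained (only x ≠ 0 → x * x⁻¹ = 1 is required).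
record Field : Set₁ where
  infixl 7 _*_
  infixl 6 _+_ _-_
  field
    Carrier : Set
    _+_ _*_ : Op₂ Carrier
    -_      : Op₁ Carrier
    0# 1#   : Carrier
    _⁻¹     : Op₁ Carrier
    isCommutativeRing : IsCommutativeRing _≡_ _+_ _*_ -_ 0# 1#
    0≢1     : ¬ (0# ≡ 1#)
    *-inverse : ∀ x → ¬ (x ≡ 0#) → x * (x ⁻¹) ≡ 1#

  _-_ : Op₂ Carrier
  x - y = x + (- y)

Mat3 : Set → Set
Mat3 A = Fin 3 → Fin 3 → A

module Cubic (F : Field) (δ : Field.Carrier F) where
  open Field F

  IsCube : Carrier → Set
  IsCube a = Data.Product.Σ Carrier (λ x → x * x * x ≡ a)

  -- the cubic extension F(δ^{1/3}) = F[θ]/(θ³ - δ), elements written in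
  -- coordinates (α₁ , α₂ , α₃) w.r.t. the basis 1, δ^{1/3}, δ^{2/3}
  E : Set
  E = Carrier × Carrier × Carrier

  c₁ c₂ c₃ : E → Carrier
  c₁ (a , b , c) = a
  c₂ (a , b , c) = b
  c₃ (a , b , c) = c

  emb : Carrier → E
  emb x = (x , 0# , 0#)

  0E 1E : E
  0E = emb 0#
  1E = emb 1#

  _+E_ : E → E → E
  (a , b , c) +E (a' , b' , c') = (a + a' , b + b' , c + c')

  _*E_ : E → E → E
  (a , b , c) *E (a' , b' , c') =
    ( a * a' + δ * (b * c' + c * b')
    , a * b' + b * a' + δ * (c * c')
    , a * c' + b * b' + c * a' )

  three : Carrier
  three = 1# + 1# + 1#

  norm : E → Carrier
  norm (a , b , c) =
    a * a * a + δ * (b * b * b) + δ * δ * (c * c * c) - three * δ * (a * b * c)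

  -- inverse via the adjugate formula (0 is sent to 0)
  invE : E → E
  invE (a , b , c) =
    let k = norm (a , b , c) ⁻¹ in
    ( k * (a * a - δ * (b * c)) , k * (δ * (c * c) - a * b) , k * (b * b - a * c) )

  _/E_ : E → E → E
  x /E y = x *E invE y

  InH : E × E → Set
  InH (α , β) = ¬ (c₂ α * c₃ β - c₃ α * c₂ β ≡ 0#)

  det3 : Mat3 Carrier → Carrier
  det3 m =
      m 0F 0F * (m 1F 1F * m 2F 2F - m 1F 2F * m 2F 1F)
    - m 0F 1F * (m 1F 0F * m 2F 2F - m 1F 2F * m 2F 0F)
    + m 0F 2F * (m 1F 0F * m 2F 1F - m 1F 1F * m 2F 0F)
    where
    0F 1F 2F : Fin 3
    0F = zero
    1F = suc zero
    2F = suc (suc zero)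

  IsGL3 : Mat3 Carrier → Set
  IsGL3 m = ¬ (det3 m ≡ 0#)

  I3 : Mat3 Carrier
  I3 zero zero = 1#
  I3 (suc zero) (suc zero) = 1#
  I3 (suc (suc zero)) (suc (suc zero)) = 1#
  I3 _ _ = 0#

  _⊗_ : Mat3 Carrier → Mat3 Carrier → Mat3 Carrier
  (m ⊗ n) i j = m i zero * n zero j + m i (suc zero) * n (suc zero) j
              + m i (suc (suc zero)) * n (suc (suc zero)) j

  lin : Carrier → Carrier → Carrier → E → E → E
  lin x y z α β = ((emb x *E α) +E (emb y *E β)) +E emb z

  denom : Mat3 Carrier → E × E → E
  denom m (α , β) =
    lin (m (suc (suc zero)) zero) (m (suc (suc zero)) (suc zero))
        (m (suc (suc zero)) (suc (suc zero))) α β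

  act : Mat3 Carrier → E × E → E × E
  act m (α , β) =
    ( lin (m zero zero) (m zero (suc zero)) (m zero (suc (suc zero))) α β /E denom m (α , β)
    , lin (m (suc zero) zero) (m (suc zero) (suc zero)) (m (suc zero) (suc (suc zero))) α β
        /E denom m (α , β) )

module Submission where

-- The third row D = rα + sβ + t and the first two rows A, B of g, applied to
-- (α , β), have coordinate vectors g · (coordinates of 1, α, β); hence the
-- 3×3 determinant of the coordinates of D, A, B is det g · ω(α , β), where
-- ω(α , β) = α₂β₃ − α₃β₂.  So D ≠ 0 whenever g ∈ GL₃ and (α , β) ∈ H.
-- Multiplying D, A, B by D⁻¹ multiplies that determinant by the norm
-- N(D⁻¹) (the determinant of multiplication by D⁻¹), and turns it into
-- ω(A/D , B/D).  Nonzero elements have nonzero norm because δ is not a cube: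
-- adj (adj u) = N(u) u, and a nonzero v = (p , q , r) with adj v = 0 has
-- q² = pr, pq = δr² and r ≠ 0, so q/r is a cube root of δ.  Finally
-- the numerators and denominator of g · (h · z) are those of (gh) · z, all
-- multiplied by the denominator of h · z, which cancels.

open import Algebra.Bundles using (CommutativeRing)
open import Algebra.Solver.Ring.AlmostCommutativeRing
  using (fromCommutativeRing; _-Raw-AlmostCommutative⟶_)
open import Data.Fin using (Fin; zero; suc; #_; _↑ˡ_; _↑ʳ_; combine)
open import Data.Fin.Properties using (inj⇒≟)
open import Data.Integer as ℤ using (ℤ; +_; -[1+_]; _⊖_; _◃_; sign; ∣_∣)
import Data.Integer.Properties as ℤ
open import Data.Maybe using (just; nothing)
open import Data.Nat as ℕ using (ℕ; zero; suc; _^_; _%_)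
open import Data.Nat.Primality using (Prime)
import Data.Nat.Properties as ℕ
open import Data.Product using (_×_; _,_; proj₁; proj₂)
open import Data.Sign as Sign using (Sign)
open import Data.Vec using (Vec; []; _∷_)
open import Function.Bundles using (_⤖_; Bijection)
open import Function.Construct.Symmetry using (⤖-sym)
open import Relation.Binary.Definitions using (DecidableEquality)
import Relation.Binary.PropositionalEquality as ≡
open import Relation.Binary.PropositionalEquality using (_≡_; _≢_)
open import Relation.Nullary using (¬_; yes; no; WeaklyDecidable)
open import Relation.Nullary.Decidable using (decidable-stable)

open import Defs

module IntegerCoefficients {c ℓ} (R : CommutativeRing c ℓ) where
  open CommutativeRing R
  open import Algebra.Properties.Semiring.Mult.TCOptimised semiring using (1+×; ×-homo-+; ×1-homo-*)
    renaming (_×_ to _×′_)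
  open import Algebra.Properties.Ring ring using (-1*x≈-x)
  open import Algebra.Properties.AbelianGroup +-abelianGroup
    using (⁻¹-involutive; ε⁻¹≈ε; ⁻¹-anti-homo-∙; ⁻¹-∙-comm; xyx⁻¹≈y)
  open import Algebra.Properties.CommutativeSemigroup *-commutativeSemigroup using (interchange)
  open import Relation.Binary.Reasoning.Setoid setoid

  -- The tail-call-optimised _×_ gives ⟦ + 1 ⟧ℤ = 1# definitionally, so that
  -- polynomial constants evaluate literally to terms such as three = 1# + 1# + 1#.
  ⟦_⟧ℤ : ℤ → Carrier
  ⟦ + n ⟧ℤ = n ×′ 1#
  ⟦ -[1+ n ] ⟧ℤ = - (suc n ×′ 1#)

  [z+x]-[z+y]≈x-y : ∀ x y z → (z + x) - (z + y) ≈ x - y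
  [z+x]-[z+y]≈x-y x y z = begin
    (z + x) - (z + y)      ≈⟨ +-congˡ (⁻¹-anti-homo-∙ z y) ⟩
    (z + x) + (- y + - z)  ≈⟨ +-assoc (z + x) (- y) (- z) ⟨
    (z + x) + - y + - z    ≈⟨ +-congʳ (+-assoc z x (- y)) ⟩
    z + (x - y) + - z      ≈⟨ xyx⁻¹≈y z (x - y) ⟩
    x - y                  ∎

  ⊖-homo : ∀ m n → ⟦ m ⊖ n ⟧ℤ ≈ m ×′ 1# - n ×′ 1#
  ⊖-homo zero    zero    = sym (-‿inverseʳ 0#)
  ⊖-homo zero    (suc n) = sym (+-identityˡ _)
  ⊖-homo (suc m) zero    = sym (trans (+-congˡ ε⁻¹≈ε) (+-identityʳ _))
  ⊖-homo (suc m) (suc n) = begin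
    ⟦ suc m ⊖ suc n ⟧ℤ               ≡⟨ ≡.cong ⟦_⟧ℤ (ℤ.[1+m]⊖[1+n]≡m⊖n m n) ⟩
    ⟦ m ⊖ n ⟧ℤ                       ≈⟨ ⊖-homo m n ⟩
    m ×′ 1# - n ×′ 1#                ≈⟨ [z+x]-[z+y]≈x-y (m ×′ 1#) (n ×′ 1#) 1# ⟨
    (1# + m ×′ 1#) - (1# + n ×′ 1#)  ≈⟨ +-cong (1+× m 1#) (-‿cong (1+× n 1#)) ⟨
    suc m ×′ 1# - suc n ×′ 1#        ∎

  +-homo : ∀ i j → ⟦ i ℤ.+ j ⟧ℤ ≈ ⟦ i ⟧ℤ + ⟦ j ⟧ℤ
  +-homo (+ m)    (+ n)    = ×-homo-+ 1# m n
  +-homo (+ m)    -[1+ n ] = ⊖-homo m (suc n)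
  +-homo -[1+ m ] (+ n)    = trans (⊖-homo n (suc m)) (+-comm _ _)
  +-homo -[1+ m ] -[1+ n ] = begin
    - (suc (suc (m ℕ.+ n)) ×′ 1#)      ≡⟨ ≡.cong (λ k → - (suc k ×′ 1#)) (ℕ.+-suc m n) ⟨
    - ((suc m ℕ.+ suc n) ×′ 1#)        ≈⟨ -‿cong (×-homo-+ 1# (suc m) (suc n)) ⟩
    - (suc m ×′ 1# + suc n ×′ 1#)      ≈⟨ ⁻¹-∙-comm (suc m ×′ 1#) (suc n ×′ 1#) ⟨
    - (suc m ×′ 1#) + - (suc n ×′ 1#)  ∎

  ⟦_⟧Sign : Sign → Carrier
  ⟦ Sign.+ ⟧Sign = 1#
  ⟦ Sign.- ⟧Sign = - 1#

  Sign-*-homo : ∀ s t → ⟦ s Sign.* t ⟧Sign ≈ ⟦ s ⟧Sign * ⟦ t ⟧Sign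
  Sign-*-homo Sign.+ t      = sym (*-identityˡ _)
  Sign-*-homo Sign.- Sign.+ = sym (*-identityʳ _)
  Sign-*-homo Sign.- Sign.- = sym (trans (-1*x≈-x (- 1#)) (⁻¹-involutive 1#))

  ◃-homo : ∀ s n → ⟦ s ◃ n ⟧ℤ ≈ ⟦ s ⟧Sign * n ×′ 1#
  ◃-homo s      zero    = sym (zeroʳ _)
  ◃-homo Sign.+ (suc n) = sym (*-identityˡ _)
  ◃-homo Sign.- (suc n) = sym (-1*x≈-x _)

  *-homo : ∀ i j → ⟦ i ℤ.* j ⟧ℤ ≈ ⟦ i ⟧ℤ * ⟦ j ⟧ℤ
  *-homo i j = begin
    ⟦ sign i Sign.* sign j ◃ ∣ i ∣ ℕ.* ∣ j ∣ ⟧ℤ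
      ≈⟨ ◃-homo (sign i Sign.* sign j) (∣ i ∣ ℕ.* ∣ j ∣) ⟩
    ⟦ sign i Sign.* sign j ⟧Sign * (∣ i ∣ ℕ.* ∣ j ∣) ×′ 1#
      ≈⟨ *-cong (Sign-*-homo (sign i) (sign j)) (×1-homo-* ∣ i ∣ ∣ j ∣) ⟩
    (⟦ sign i ⟧Sign * ⟦ sign j ⟧Sign) * (∣ i ∣ ×′ 1# * ∣ j ∣ ×′ 1#)
      ≈⟨ interchange _ _ _ _ ⟩
    (⟦ sign i ⟧Sign * ∣ i ∣ ×′ 1#) * (⟦ sign j ⟧Sign * ∣ j ∣ ×′ 1#)
      ≈⟨ *-cong (◃-homo (sign i) ∣ i ∣) (◃-homo (sign j) ∣ j ∣) ⟨
    ⟦ sign i ◃ ∣ i ∣ ⟧ℤ * ⟦ sign j ◃ ∣ j ∣ ⟧ℤ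
      ≡⟨ ≡.cong₂ (λ k l → ⟦ k ⟧ℤ * ⟦ l ⟧ℤ) (ℤ.◃-inverse i) (ℤ.◃-inverse j) ⟩
    ⟦ i ⟧ℤ * ⟦ j ⟧ℤ
      ∎

  -‿homo : ∀ i → ⟦ ℤ.- i ⟧ℤ ≈ - ⟦ i ⟧ℤ
  -‿homo (+ zero)  = sym ε⁻¹≈ε
  -‿homo (+ suc n) = refl
  -‿homo -[1+ n ]  = sym (⁻¹-involutive _)

  homomorphism : ℤ.+-*-rawRing -Raw-AlmostCommutative⟶ fromCommutativeRing R
  homomorphism = record
    { ⟦_⟧    = ⟦_⟧ℤ
    ; +-homo = +-homo
    ; *-homo = *-homo
    ; -‿homo = -‿homo
    ; 0-homo = refl
    ; 1-homo = refl
    }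

  ⟦⟧ℤ-weaklyDecidable : ∀ i j → WeaklyDecidable (⟦ i ⟧ℤ ≈ ⟦ j ⟧ℤ)
  ⟦⟧ℤ-weaklyDecidable i j with i ℤ.≟ j
  ... | yes ≡.refl = just refl
  ... | no _       = nothing

  open import Algebra.Solver.Ring ℤ.+-*-rawRing (fromCommutativeRing R) homomorphism ⟦⟧ℤ-weaklyDecidable public

module FieldProperties (F : Field) where
  open Field F

  commutativeRing : CommutativeRing _ _
  commutativeRing = record { isCommutativeRing = isCommutativeRing }

  open CommutativeRing commutativeRing using (*-comm; *-assoc; *-identityˡ; zeroʳ)
  open ≡ using (cong)
  open ≡.≡-Reasoning

  x≢0∧x*y≡0⇒y≡0 : ∀ {x y} → x ≢ 0# → x * y ≡ 0# → y ≡ 0#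
  x≢0∧x*y≡0⇒y≡0 {x} {y} x≢0 xy≡0 = begin
    y                ≡⟨ *-identityˡ y ⟨
    1# * y           ≡⟨ cong (_* y) (*-inverse x x≢0) ⟨
    x * x ⁻¹ * y     ≡⟨ cong (_* y) (*-comm x (x ⁻¹)) ⟩
    x ⁻¹ * x * y     ≡⟨ *-assoc (x ⁻¹) x y ⟩
    x ⁻¹ * (x * y)   ≡⟨ cong (x ⁻¹ *_) xy≡0 ⟩
    x ⁻¹ * 0#        ≡⟨ zeroʳ (x ⁻¹) ⟩
    0#               ∎

  x≢0∧y≢0⇒x*y≢0 : ∀ {x y} → x ≢ 0# → y ≢ 0# → x * y ≢ 0#
  x≢0∧y≢0⇒x*y≢0 x≢0 y≢0 xy≡0 = y≢0 (x≢0∧x*y≡0⇒y≡0 x≢0 xy≡0)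

  x*x≡0⇒x≡0 : DecidableEquality Carrier → ∀ {x} → x * x ≡ 0# → x ≡ 0#
  x*x≡0⇒x≡0 _≟_ {x} xx≡0 with x ≟ 0#
  ... | yes x≡0 = x≡0
  ... | no  x≢0 = x≢0∧x*y≡0⇒y≡0 x≢0 xx≡0

module CubicExtension (F : Field) (δ : Field.Carrier F) where
  open Field F
  open Cubic F δ
  open FieldProperties F
  open IntegerCoefficients commutativeRing
  open CommutativeRing commutativeRing using (+-group; zeroˡ; zeroʳ)
  open import Algebra.Properties.Group +-group using (x∙y⁻¹≈ε⇒x≈y)
  open ≡ using (refl; sym; trans; cong; cong₂)
  open ≡.≡-Reasoning

  -- u *E adj u ≡ emb (norm u); invE in Defs is norm u ⁻¹ times adj u.
  adj : E → E
  adj (a , b , c) = (a * a - δ * (b * c) , δ * (c * c) - a * b , b * b - a * c)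

  ω : E → E → Carrier
  ω α β = c₂ α * c₃ β - c₃ α * c₂ β

  detE : E → E → E → Carrier
  detE (a , b , c) (d , e , f) (r , s , t) =
    a * (e * t - f * s) - b * (d * t - f * r) + c * (d * s - e * r)

  row : Mat3 Carrier → Fin 3 → E × E → E
  row g i (α , β) = lin (g i (# 0)) (g i (# 1)) (g i (# 2)) α β

  PE : ℕ → Set
  PE n = Polynomial n × Polynomial n × Polynomial n

  ⟦_⟧E : ∀ {n} → PE n → Vec Carrier n → E
  ⟦ a , b , c ⟧E ρ = ⟦ a ⟧ ρ , ⟦ b ⟧ ρ , ⟦ c ⟧ ρ

  proveE : ∀ {n} (ρ : Vec Carrier n) (x y : PE n) →
           ⟦ proj₁ x ⟧↓ ρ ≡ ⟦ proj₁ y ⟧↓ ρ →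
           ⟦ proj₁ (proj₂ x) ⟧↓ ρ ≡ ⟦ proj₁ (proj₂ y) ⟧↓ ρ →
           ⟦ proj₂ (proj₂ x) ⟧↓ ρ ≡ ⟦ proj₂ (proj₂ y) ⟧↓ ρ →
           ⟦ x ⟧E ρ ≡ ⟦ y ⟧E ρ
  proveE ρ (a , b , c) (a′ , b′ , c′) p q r =
    cong₂ _,_ (prove ρ a a′ p) (cong₂ _,_ (prove ρ b b′ q) (prove ρ c c′ r))

  module Syntax {n : ℕ} where
    P : Set
    P = Polynomial (suc n)

    δₚ 0ₚ 1ₚ 3ₚ : P
    δₚ = var zero
    0ₚ = con (+ 0)
    1ₚ = con (+ 1)
    3ₚ = 1ₚ :+ 1ₚ :+ 1ₚ

    varE : Fin (suc n) → Fin (suc n) → Fin (suc n) → PE (suc n)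
    varE i j k = var i , var j , var k

    embₚ : P → PE (suc n)
    embₚ x = x , 0ₚ , 0ₚ

    _+ₚ_ _*ₚ_ : PE (suc n) → PE (suc n) → PE (suc n)
    (a , b , c) +ₚ (a′ , b′ , c′) = a :+ a′ , b :+ b′ , c :+ c′
    (a , b , c) *ₚ (a′ , b′ , c′) =
      a :* a′ :+ δₚ :* (b :* c′ :+ c :* b′) ,
      a :* b′ :+ b :* a′ :+ δₚ :* (c :* c′) ,
      a :* c′ :+ b :* b′ :+ c :* a′

    _·ₚ_ : P → PE (suc n) → PE (suc n)
    k ·ₚ (a , b , c) = k :* a , k :* b , k :* c

    normₚ : PE (suc n) → P
    normₚ (a , b , c) =
      a :* a :* a :+ δₚ :* (b :* b :* b) :+ δₚ :* δₚ :* (c :* c :* c) :- 3ₚ :* δₚ :* (a :* b :* c)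

    adjₚ : PE (suc n) → PE (suc n)
    adjₚ (a , b , c) = a :* a :- δₚ :* (b :* c) , δₚ :* (c :* c) :- a :* b , b :* b :- a :* c

    linₚ : P → P → P → PE (suc n) → PE (suc n) → PE (suc n)
    linₚ x y w α β = ((embₚ x *ₚ α) +ₚ (embₚ y *ₚ β)) +ₚ embₚ w

    detₚ : PE (suc n) → PE (suc n) → PE (suc n) → P
    detₚ (a , b , c) (d , e , f) (r , s , t) =
      a :* (e :* t :- f :* s) :- b :* (d :* t :- f :* r) :+ c :* (d :* s :- e :* r)

    ωₚ : PE (suc n) → PE (suc n) → P
    ωₚ (_ , b , c) (_ , e , f) = b :* f :- c :* e

  open Syntax

  *E-identityˡ : ∀ u → 1E *E u ≡ u
  *E-identityˡ (a , b , c) =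
    proveE (δ ∷ a ∷ b ∷ c ∷ []) (embₚ 1ₚ *ₚ varE (# 1) (# 2) (# 3)) (varE (# 1) (# 2) (# 3)) refl refl refl

  *E-identityʳ : ∀ u → u *E 1E ≡ u
  *E-identityʳ (a , b , c) =
    proveE (δ ∷ a ∷ b ∷ c ∷ []) (varE (# 1) (# 2) (# 3) *ₚ embₚ 1ₚ) (varE (# 1) (# 2) (# 3)) refl refl refl

  *E-zeroˡ : ∀ u → 0E *E u ≡ 0E
  *E-zeroˡ (a , b , c) =
    proveE (δ ∷ a ∷ b ∷ c ∷ []) (embₚ 0ₚ *ₚ varE (# 1) (# 2) (# 3)) (embₚ 0ₚ) refl refl refl

  *E-zeroʳ : ∀ u → u *E 0E ≡ 0E
  *E-zeroʳ (a , b , c) =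
    proveE (δ ∷ a ∷ b ∷ c ∷ []) (varE (# 1) (# 2) (# 3) *ₚ embₚ 0ₚ) (embₚ 0ₚ) refl refl refl

  *E-invE : ∀ u → u *E invE u ≡ emb (norm u * norm u ⁻¹)
  *E-invE (a , b , c) =
    proveE (δ ∷ a ∷ b ∷ c ∷ norm (a , b , c) ⁻¹ ∷ [])
      (U *ₚ (var (# 4) ·ₚ adjₚ U)) (embₚ (normₚ U :* var (# 4))) refl refl refl
    where
    U : PE 5
    U = varE (# 1) (# 2) (# 3)

  adj-adj : ∀ u → adj (adj u) ≡ emb (norm u) *E u
  adj-adj (a , b , c) =
    proveE (δ ∷ a ∷ b ∷ c ∷ []) (adjₚ (adjₚ U)) (embₚ (normₚ U) *ₚ U) refl refl refl
    where
    U : PE 4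
    U = varE (# 1) (# 2) (# 3)

  -- The matrix of multiplication by m in the basis 1, δ^{1/3}, δ^{2/3} has determinant norm m.
  detE-*E : ∀ u v w m → detE (u *E m) (v *E m) (w *E m) ≡ norm m * detE u v w
  detE-*E (u₁ , u₂ , u₃) (v₁ , v₂ , v₃) (w₁ , w₂ , w₃) (m₁ , m₂ , m₃) =
    prove (δ ∷ u₁ ∷ u₂ ∷ u₃ ∷ v₁ ∷ v₂ ∷ v₃ ∷ w₁ ∷ w₂ ∷ w₃ ∷ m₁ ∷ m₂ ∷ m₃ ∷ [])
      (detₚ (U *ₚ M) (V *ₚ M) (W *ₚ M)) (normₚ M :* detₚ U V W) refl
    where
    U V W M : PE 13
    U = varE (# 1) (# 2) (# 3)
    V = varE (# 4) (# 5) (# 6)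
    W = varE (# 7) (# 8) (# 9)
    M = varE (# 10) (# 11) (# 12)

  detE-1E : ∀ u v → detE 1E u v ≡ ω u v
  detE-1E (u₁ , u₂ , u₃) (v₁ , v₂ , v₃) =
    prove (δ ∷ u₁ ∷ u₂ ∷ u₃ ∷ v₁ ∷ v₂ ∷ v₃ ∷ []) (detₚ (embₚ 1ₚ) U V) (ωₚ U V) refl
    where
    U V : PE 7
    U = varE (# 1) (# 2) (# 3)
    V = varE (# 4) (# 5) (# 6)

  detE-0E : ∀ u v → detE 0E u v ≡ 0#
  detE-0E (u₁ , u₂ , u₃) (v₁ , v₂ , v₃) =
    prove (δ ∷ u₁ ∷ u₂ ∷ u₃ ∷ v₁ ∷ v₂ ∷ v₃ ∷ []) (detₚ (embₚ 0ₚ) U V) 0ₚ refl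
    where
    U V : PE 7
    U = varE (# 1) (# 2) (# 3)
    V = varE (# 4) (# 5) (# 6)

  detE-rows : ∀ g α β →
    detE (row g (# 2) (α , β)) (row g (# 0) (α , β)) (row g (# 1) (α , β)) ≡ det3 g * ω α β
  detE-rows g (a₁ , a₂ , a₃) (b₁ , b₂ , b₃) =
    prove (δ ∷ a₁ ∷ a₂ ∷ a₃ ∷ b₁ ∷ b₂ ∷ b₃ ∷
           g (# 0) (# 0) ∷ g (# 0) (# 1) ∷ g (# 0) (# 2) ∷
           g (# 1) (# 0) ∷ g (# 1) (# 1) ∷ g (# 1) (# 2) ∷
           g (# 2) (# 0) ∷ g (# 2) (# 1) ∷ g (# 2) (# 2) ∷ [])
      (detₚ (rowₚ (# 13) (# 14) (# 15)) (rowₚ (# 7) (# 8) (# 9)) (rowₚ (# 10) (# 11) (# 12)))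
      (detₚ (varE (# 7) (# 8) (# 9)) (varE (# 10) (# 11) (# 12)) (varE (# 13) (# 14) (# 15)) :* ωₚ A B)
      refl
    where
    A B : PE 16
    A = varE (# 1) (# 2) (# 3)
    B = varE (# 4) (# 5) (# 6)
    rowₚ : Fin 16 → Fin 16 → Fin 16 → PE 16
    rowₚ i j k = linₚ (var i) (var j) (var k) A B

  lin-*E : ∀ x y w a b k →
    lin x y w (a *E k) (b *E k) ≡ (((emb x *E a) +E (emb y *E b)) *E k) +E (emb w *E 1E)
  lin-*E x y w (a₁ , a₂ , a₃) (b₁ , b₂ , b₃) (k₁ , k₂ , k₃) =
    proveE (δ ∷ x ∷ y ∷ w ∷ a₁ ∷ a₂ ∷ a₃ ∷ b₁ ∷ b₂ ∷ b₃ ∷ k₁ ∷ k₂ ∷ k₃ ∷ [])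
      (linₚ X Y W (A *ₚ K) (B *ₚ K))
      ((((embₚ X *ₚ A) +ₚ (embₚ Y *ₚ B)) *ₚ K) +ₚ (embₚ W *ₚ embₚ 1ₚ))
      refl refl refl
    where
    X Y W : Polynomial 13
    X = var (# 1)
    Y = var (# 2)
    W = var (# 3)
    A B K : PE 13
    A = varE (# 4) (# 5) (# 6)
    B = varE (# 7) (# 8) (# 9)
    K = varE (# 10) (# 11) (# 12)

  *E-distribʳ-collect : ∀ u v d k → (u *E k) +E (v *E (d *E k)) ≡ (u +E (v *E d)) *E k
  *E-distribʳ-collect (u₁ , u₂ , u₃) (v₁ , v₂ , v₃) (d₁ , d₂ , d₃) (k₁ , k₂ , k₃) =
    proveE (δ ∷ u₁ ∷ u₂ ∷ u₃ ∷ v₁ ∷ v₂ ∷ v₃ ∷ d₁ ∷ d₂ ∷ d₃ ∷ k₁ ∷ k₂ ∷ k₃ ∷ [])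
      ((U *ₚ K) +ₚ (V *ₚ (D *ₚ K))) ((U +ₚ (V *ₚ D)) *ₚ K) refl refl refl
    where
    U V D K : PE 13
    U = varE (# 1) (# 2) (# 3)
    V = varE (# 4) (# 5) (# 6)
    D = varE (# 7) (# 8) (# 9)
    K = varE (# 10) (# 11) (# 12)

  row-⊗ : ∀ g h i z → row (g ⊗ h) i z ≡
    ((emb (g i (# 0)) *E row h (# 0) z) +E (emb (g i (# 1)) *E row h (# 1) z))
      +E (emb (g i (# 2)) *E row h (# 2) z)
  row-⊗ g h i ((a₁ , a₂ , a₃) , (b₁ , b₂ , b₃)) =
    proveE (δ ∷ g i (# 0) ∷ g i (# 1) ∷ g i (# 2) ∷
            h (# 0) (# 0) ∷ h (# 0) (# 1) ∷ h (# 0) (# 2) ∷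
            h (# 1) (# 0) ∷ h (# 1) (# 1) ∷ h (# 1) (# 2) ∷
            h (# 2) (# 0) ∷ h (# 2) (# 1) ∷ h (# 2) (# 2) ∷
            a₁ ∷ a₂ ∷ a₃ ∷ b₁ ∷ b₂ ∷ b₃ ∷ [])
      (linₚ (Σₚ (# 0)) (Σₚ (# 1)) (Σₚ (# 2)) A B)
      (((embₚ (G (# 0)) *ₚ Rₚ (# 0)) +ₚ (embₚ (G (# 1)) *ₚ Rₚ (# 1))) +ₚ (embₚ (G (# 2)) *ₚ Rₚ (# 2)))
      refl refl refl
    where
    G : Fin 3 → Polynomial 19
    G j = var ((1 ↑ʳ j) ↑ˡ 15)
    H : Fin 3 → Fin 3 → Polynomial 19
    H k l = var ((4 ↑ʳ combine k l) ↑ˡ 6)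
    Σₚ : Fin 3 → Polynomial 19
    Σₚ j = G (# 0) :* H (# 0) j :+ G (# 1) :* H (# 1) j :+ G (# 2) :* H (# 2) j
    A B : PE 19
    A = varE (# 13) (# 14) (# 15)
    B = varE (# 16) (# 17) (# 18)
    Rₚ : Fin 3 → PE 19
    Rₚ j = linₚ (H j (# 0)) (H j (# 1)) (H j (# 2)) A B

  row₀-I3 : ∀ α β → row I3 (# 0) (α , β) ≡ α
  row₀-I3 (a₁ , a₂ , a₃) (b₁ , b₂ , b₃) =
    proveE (δ ∷ a₁ ∷ a₂ ∷ a₃ ∷ b₁ ∷ b₂ ∷ b₃ ∷ []) (linₚ 1ₚ 0ₚ 0ₚ A B) A refl refl refl
    where
    A B : PE 7
    A = varE (# 1) (# 2) (# 3)
    B = varE (# 4) (# 5) (# 6)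

  row₁-I3 : ∀ α β → row I3 (# 1) (α , β) ≡ β
  row₁-I3 (a₁ , a₂ , a₃) (b₁ , b₂ , b₃) =
    proveE (δ ∷ a₁ ∷ a₂ ∷ a₃ ∷ b₁ ∷ b₂ ∷ b₃ ∷ []) (linₚ 0ₚ 1ₚ 0ₚ A B) B refl refl refl
    where
    A B : PE 7
    A = varE (# 1) (# 2) (# 3)
    B = varE (# 4) (# 5) (# 6)

  row₂-I3 : ∀ z → row I3 (# 2) z ≡ 1E
  row₂-I3 ((a₁ , a₂ , a₃) , (b₁ , b₂ , b₃)) =
    proveE (δ ∷ a₁ ∷ a₂ ∷ a₃ ∷ b₁ ∷ b₂ ∷ b₃ ∷ []) (linₚ 0ₚ 0ₚ 1ₚ A B) (embₚ 1ₚ) refl refl refl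
    where
    A B : PE 7
    A = varE (# 1) (# 2) (# 3)
    B = varE (# 4) (# 5) (# 6)

  norm-1E : norm 1E ≡ 1#
  norm-1E = prove (δ ∷ []) (normₚ (embₚ 1ₚ)) 1ₚ refl

  invE-1E : invE 1E ≡ 1E
  invE-1E = begin
    invE 1E                         ≡⟨ *E-identityˡ (invE 1E) ⟨
    1E *E invE 1E                   ≡⟨ *E-invE 1E ⟩
    emb (norm 1E * norm 1E ⁻¹)      ≡⟨ cong emb (*-inverse (norm 1E) norm1E≢0) ⟩
    1E                              ∎
    where
    norm1E≢0 : norm 1E ≢ 0#
    norm1E≢0 n≡0 = 0≢1 (trans (sym n≡0) norm-1E)

  act-I3 : ∀ z → act I3 z ≡ z
  act-I3 (α , β) = cong₂ _,_ (trans (/D (row I3 (# 0) (α , β))) (row₀-I3 α β))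
                             (trans (/D (row I3 (# 1) (α , β))) (row₁-I3 α β))
    where
    /D : ∀ u → u /E row I3 (# 2) (α , β) ≡ u
    /D u = begin
      u *E invE (row I3 (# 2) (α , β))  ≡⟨ cong (λ d → u *E invE d) (row₂-I3 (α , β)) ⟩
      u *E invE 1E                      ≡⟨ cong (u *E_) invE-1E ⟩
      u *E 1E                           ≡⟨ *E-identityʳ u ⟩
      u                                 ∎

  cube-root-of-δ : ∀ {p q r} → q * q ≡ p * r → p * q ≡ δ * (r * r) → r ≢ 0# → IsCube δ
  cube-root-of-δ {p} {q} {r} q²≡pr pq≡δr² r≢0 = q * r ⁻¹ , (begin
    q * s * (q * s) * (q * s)
      ≡⟨ prove ρ (Q :* S :* (Q :* S) :* (Q :* S)) (Q :* Q :* Q :* S³) refl ⟩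
    q * q * q * s³
      ≡⟨ cong (λ t → t * q * s³) q²≡pr ⟩
    p * r * q * s³
      ≡⟨ prove ρ (Pₚ :* R :* Q :* S³) (Pₚ :* Q :* R :* S³) refl ⟩
    p * q * r * s³
      ≡⟨ cong (λ t → t * r * s³) pq≡δr² ⟩
    δ * (r * r) * r * s³
      ≡⟨ prove ρ (δₚ :* (R :* R) :* R :* S³) (δₚ :* (R :* S :* (R :* S) :* (R :* S))) refl ⟩
    δ * (r * s * (r * s) * (r * s))
      ≡⟨ cong (λ t → δ * (t * t * t)) (*-inverse r r≢0) ⟩
    δ * (1# * 1# * 1#)
      ≡⟨ prove (δ ∷ []) (δₚ :* (1ₚ :* 1ₚ :* 1ₚ)) δₚ refl ⟩
    δ
      ∎)
    where
    s s³ : Carrier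
    s = r ⁻¹
    s³ = s * s * s
    ρ : Vec Carrier 5
    ρ = δ ∷ p ∷ q ∷ r ∷ s ∷ []
    Pₚ Q R S S³ : Polynomial 5
    Pₚ = var (# 1)
    Q = var (# 2)
    R = var (# 3)
    S = var (# 4)
    S³ = S :* S :* S

  denom≢0E : ∀ g → IsGL3 g → ∀ z → InH z → denom g z ≢ 0E
  denom≢0E g g∈GL (α , β) z∈H D≡0 = x≢0∧y≢0⇒x*y≢0 g∈GL z∈H (begin
    det3 g * ω α β        ≡⟨ detE-rows g α β ⟨
    detE D A B            ≡⟨ cong (λ d → detE d A B) D≡0 ⟩
    detE 0E A B           ≡⟨ detE-0E A B ⟩
    0#                    ∎)
    where
    A B D : E
    A = row g (# 0) (α , β)
    B = row g (# 1) (α , β)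
    D = row g (# 2) (α , β)

  module _ (_≟_ : DecidableEquality Carrier) (δ-noncube : ¬ IsCube δ) where

    adj≡0E⇒≡0E : ∀ v → adj v ≡ 0E → v ≡ 0E
    adj≡0E⇒≡0E (p , q , r) adj≡0 = cong₂ _,_ p≡0 (cong₂ _,_ q≡0 r≡0)
      where
      p²≡δqr : p * p ≡ δ * (q * r)
      p²≡δqr = x∙y⁻¹≈ε⇒x≈y _ _ (cong c₁ adj≡0)
      δr²≡pq : δ * (r * r) ≡ p * q
      δr²≡pq = x∙y⁻¹≈ε⇒x≈y _ _ (cong c₂ adj≡0)
      q²≡pr : q * q ≡ p * r
      q²≡pr = x∙y⁻¹≈ε⇒x≈y _ _ (cong c₃ adj≡0)
      r≡0 : r ≡ 0#
      r≡0 = decidable-stable (r ≟ 0#) (λ r≢0 → δ-noncube (cube-root-of-δ q²≡pr (sym δr²≡pq) r≢0))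
      q≡0 : q ≡ 0#
      q≡0 = x*x≡0⇒x≡0 _≟_ (trans q²≡pr (trans (cong (p *_) r≡0) (zeroʳ p)))
      p≡0 : p ≡ 0#
      p≡0 = x*x≡0⇒x≡0 _≟_ (trans p²≡δqr (trans (cong (λ t → δ * (t * r)) q≡0)
                                          (trans (cong (δ *_) (zeroˡ r)) (zeroʳ δ))))

    norm≡0⇒≡0E : ∀ u → norm u ≡ 0# → u ≡ 0E
    norm≡0⇒≡0E u N≡0 = adj≡0E⇒≡0E u (adj≡0E⇒≡0E (adj u) (begin
      adj (adj u)          ≡⟨ adj-adj u ⟩
      emb (norm u) *E u    ≡⟨ cong (λ n → emb n *E u) N≡0 ⟩
      0E *E u              ≡⟨ *E-zeroˡ u ⟩
      0E                   ∎))

    *E-invE≡1E : ∀ {u} → u ≢ 0E → u *E invE u ≡ 1E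
    *E-invE≡1E {u} u≢0 = trans (*E-invE u) (cong emb (*-inverse (norm u) (λ N≡0 → u≢0 (norm≡0⇒≡0E u N≡0))))

    invE-≢0E : ∀ {u} → u ≢ 0E → invE u ≢ 0E
    invE-≢0E {u} u≢0 u⁻¹≡0 = 0≢1 (cong c₁ (begin
      0E             ≡⟨ *E-zeroʳ u ⟨
      u *E 0E        ≡⟨ cong (u *E_) u⁻¹≡0 ⟨
      u *E invE u    ≡⟨ *E-invE≡1E u≢0 ⟩
      1E             ∎))

    /E-cancelʳ : ∀ {u v w} → v ≢ 0E → (v *E w) ≢ 0E → (u *E w) /E (v *E w) ≡ u /E v
    /E-cancelʳ {u} {v} {w} v≢0 vw≢0 = begin
      (u *E w) /E (v *E w)                              ≡⟨ *E-identityʳ _ ⟨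
      ((u *E w) /E (v *E w)) *E 1E                      ≡⟨ cong (((u *E w) /E (v *E w)) *E_) (*E-invE≡1E v≢0) ⟨
      ((u *E w) /E (v *E w)) *E (v *E invE v)           ≡⟨ rearrange u (invE v) v w (invE (v *E w)) ⟨
      (u *E invE v) *E ((v *E w) *E invE (v *E w))      ≡⟨ cong ((u *E invE v) *E_) (*E-invE≡1E vw≢0) ⟩
      (u *E invE v) *E 1E                               ≡⟨ *E-identityʳ _ ⟩
      u /E v                                            ∎
      where
      rearrange : ∀ u i v w j → (u *E i) *E ((v *E w) *E j) ≡ ((u *E w) *E j) *E (v *E i)
      rearrange (u₁ , u₂ , u₃) (i₁ , i₂ , i₃) (v₁ , v₂ , v₃) (w₁ , w₂ , w₃) (j₁ , j₂ , j₃) =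
        proveE (δ ∷ u₁ ∷ u₂ ∷ u₃ ∷ i₁ ∷ i₂ ∷ i₃ ∷ v₁ ∷ v₂ ∷ v₃ ∷ w₁ ∷ w₂ ∷ w₃ ∷ j₁ ∷ j₂ ∷ j₃ ∷ [])
          ((U *ₚ I) *ₚ ((V *ₚ W) *ₚ J)) (((U *ₚ W) *ₚ J) *ₚ (V *ₚ I)) refl refl refl
        where
        U I V W J : PE 16
        U = varE (# 1) (# 2) (# 3)
        I = varE (# 4) (# 5) (# 6)
        V = varE (# 7) (# 8) (# 9)
        W = varE (# 10) (# 11) (# 12)
        J = varE (# 13) (# 14) (# 15)

    act-InH : ∀ g → IsGL3 g → ∀ z → InH z → InH (act g z)
    act-InH g g∈GL (α , β) z∈H ω≡0 =
      x≢0∧y≢0⇒x*y≢0 (λ N≡0 → invE-≢0E D≢0 (norm≡0⇒≡0E D⁻¹ N≡0)) (x≢0∧y≢0⇒x*y≢0 g∈GL z∈H) (begin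
        norm D⁻¹ * (det3 g * ω α β)               ≡⟨ cong (norm D⁻¹ *_) (detE-rows g α β) ⟨
        norm D⁻¹ * detE D A B                     ≡⟨ detE-*E D A B D⁻¹ ⟨
        detE (D *E D⁻¹) (A *E D⁻¹) (B *E D⁻¹)     ≡⟨ cong (λ d → detE d (A *E D⁻¹) (B *E D⁻¹)) (*E-invE≡1E D≢0) ⟩
        detE 1E (A *E D⁻¹) (B *E D⁻¹)             ≡⟨ detE-1E (A *E D⁻¹) (B *E D⁻¹) ⟩
        ω (A *E D⁻¹) (B *E D⁻¹)                   ≡⟨ ω≡0 ⟩
        0#                                        ∎)
      where
      A B D D⁻¹ : E
      A = row g (# 0) (α , β)
      B = row g (# 1) (α , β)
      D = row g (# 2) (α , β)
      D⁻¹ = invE D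
      D≢0 : D ≢ 0E
      D≢0 = denom≢0E g g∈GL (α , β) z∈H

    act-⊗ : ∀ g h → IsGL3 g → IsGL3 h → ∀ z → InH z → act (g ⊗ h) z ≡ act g (act h z)
    act-⊗ g h g∈GL h∈GL z z∈H = cong₂ _,_ (quotient (# 0)) (quotient (# 1))
      where
      R : Fin 3 → E
      R j = row h j z
      D⁻¹ : E
      D⁻¹ = invE (R (# 2))
      D≢0 : R (# 2) ≢ 0E
      D≢0 = denom≢0E h h∈GL z z∈H
      row-act : ∀ i → row g i (act h z) ≡ row (g ⊗ h) i z *E D⁻¹
      row-act i = begin
        row g i (act h z)
          ≡⟨ lin-*E (g i (# 0)) (g i (# 1)) (g i (# 2)) (R (# 0)) (R (# 1)) D⁻¹ ⟩
        (S *E D⁻¹) +E (emb (g i (# 2)) *E 1E)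
          ≡⟨ cong (λ t → (S *E D⁻¹) +E (emb (g i (# 2)) *E t)) (*E-invE≡1E D≢0) ⟨
        (S *E D⁻¹) +E (emb (g i (# 2)) *E (R (# 2) *E D⁻¹))
          ≡⟨ *E-distribʳ-collect S (emb (g i (# 2))) (R (# 2)) D⁻¹ ⟩
        (S +E (emb (g i (# 2)) *E R (# 2))) *E D⁻¹
          ≡⟨ cong (_*E D⁻¹) (row-⊗ g h i z) ⟨
        row (g ⊗ h) i z *E D⁻¹
          ∎
        where
        S : E
        S = (emb (g i (# 0)) *E R (# 0)) +E (emb (g i (# 1)) *E R (# 1))
      ND≢0 : row (g ⊗ h) (# 2) z *E D⁻¹ ≢ 0E
      ND≢0 e = denom≢0E g g∈GL (act h z) (act-InH h h∈GL z z∈H) (trans (row-act (# 2)) e)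
      N≢0 : row (g ⊗ h) (# 2) z ≢ 0E
      N≢0 e = ND≢0 (trans (cong (_*E D⁻¹) e) (*E-zeroˡ D⁻¹))
      quotient : ∀ i → row (g ⊗ h) i z /E row (g ⊗ h) (# 2) z ≡ row g i (act h z) /E row g (# 2) (act h z)
      quotient i = begin
        row (g ⊗ h) i z /E row (g ⊗ h) (# 2) z                  ≡⟨ /E-cancelʳ N≢0 ND≢0 ⟨
        (row (g ⊗ h) i z *E D⁻¹) /E (row (g ⊗ h) (# 2) z *E D⁻¹) ≡⟨ cong₂ _/E_ (row-act i) (row-act (# 2)) ⟨
        row g i (act h z) /E row g (# 2) (act h z)              ∎

lemma2p2 : (F : Field) (p n q : ℕ) → Prime p → q ≡ p ^ n → q % 3 ≡ 1
    → (Fin q ⤖ Field.Carrier F)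
    → (δ : Field.Carrier F) → ¬ Cubic.IsCube F δ δ
    → ((g : Mat3 (Field.Carrier F)) → Cubic.IsGL3 F δ g
         → (z : Cubic.E F δ × Cubic.E F δ) → Cubic.InH F δ z
         → ¬ (Cubic.denom F δ g z ≡ Cubic.0E F δ))
      × ((g : Mat3 (Field.Carrier F)) → Cubic.IsGL3 F δ g
         → (z : Cubic.E F δ × Cubic.E F δ) → Cubic.InH F δ z
         → Cubic.InH F δ (Cubic.act F δ g z))
      × ((z : Cubic.E F δ × Cubic.E F δ) → Cubic.InH F δ z
         → Cubic.act F δ (Cubic.I3 F δ) z ≡ z)
      × ((g h : Mat3 (Field.Carrier F)) → Cubic.IsGL3 F δ g → Cubic.IsGL3 F δ h
         → (z : Cubic.E F δ × Cubic.E F δ) → Cubic.InH F δ z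
         → Cubic.act F δ (Cubic._⊗_ F δ g h) z ≡ Cubic.act F δ g (Cubic.act F δ h z))
lemma2p2 F p n q _ _ _ Fin-q⤖F δ δ-noncube =
  denom≢0E , act-InH _≟_ δ-noncube , (λ z _ → act-I3 z) , act-⊗ _≟_ δ-noncube
  where
  open CubicExtension F δ
  _≟_ : DecidableEquality (Field.Carrier F)
  _≟_ = inj⇒≟ (Bijection.injection (⤖-sym Fin-q⤖F))
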